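{- Let $b$ be a prime, let $P$ be the infinite upper triangular Pascal matrix over $\mathbb{F}_b$, $P_{i,j}=\binom{j-1}{i-1}\bmod b$ for $i,j\ge1$ (zero if $j<i$), let $w\ge0$ be an integer and $m=(b-1)b^w$. Then: \begin{enumerate} \item[(i)] for every integer $1\le i\le b^w-1$, $\sum_{j=1}^m P_{i,j}\equiv0\pmod b$; \item[(ii)] for all integers $2\le k\le b-1$ and $1\le i\le b^w$, $\sum_{j=1}^m(P^k)_{i,j}\equiv0\pmod b$. \end{enumerate}
   Context: It is known that $(P^k)_{i,j}\equiv k^{j-i}\binom{j-1}{i-1}\pmod b$ for $j\ge i$ and $(P^k)_{i,j}=0$ otherwise. -}

module Defs where

open import Data.Nat using (ℕ; zero; suc; _+_; _*_; _∸_)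
open import Data.Nat.Combinatorics using (_C_)

sum1 : ℕ → (ℕ → ℕ) → ℕ
sum1 zero    f = 0
sum1 (suc n) f = sum1 n f + f (suc n)

-- Infinite matrices indexed by positive integers i, j ≥ 1 (entries at index 0 unused).
Mat : Set
Mat = ℕ → ℕ → ℕ

-- Pascal matrix over ℕ (entries are integers; we reduce modulo b in the statement):
-- P i j = binom(j-1, i-1) for 1 ≤ i ≤ j, and 0 if j < i (automatic since nCk = 0 for k > n)
-- and 0 at the unused index 0.
pascal : Mat
pascal zero    j       = 0
pascal (suc i) zero    = 0
pascal (suc i) (suc j) = j C i

-- Product of upper-triangular infinite matrices:
-- (A·B) i j = Σ_{l=1}^{∞} A i l * B l j, which equals the finite sum over l ≤ j
-- because B l j = 0 for l > j (B upper triangular; all powers of P are).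
_·_ : Mat → Mat → Mat
(A · B) i j = sum1 j (λ l → A i l * B l j)

identity : Mat
identity zero    j       = 0
identity (suc i) zero    = 0
identity (suc zero) (suc zero) = 1
identity (suc zero) (suc (suc j)) = 0
identity (suc (suc i)) (suc zero) = 0
identity (suc (suc i)) (suc (suc j)) = identity (suc i) (suc j)

pascalPow : ℕ → Mat
pascalPow zero    = identity
pascalPow (suc k) = pascal · pascalPow k

{-# OPTIONS --safe #-}

-- Let P[x] be the 0-indexed matrix with entries (j C i) x^(j ∸ i). Pascal's rule gives the column
-- recurrence P[x] i (1 + j) = P[x] (i - 1) j + x P[x] i j, and induction on j with it shows
-- P[a] P[c] = P[a + c]; hence P^k = P[k] (after the shift to 1-indexing) and row 0 of P[1] P[a] is
-- the binomial theorem. Telescoping the recurrence along row r of P[1 + k] gives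
--   P[1+k] r M = P[1+k] r 0 + Σ_{n<M} P[1+k] (r - 1) n + k Σ_{n<M} P[1+k] r n.
-- For M = (p - 1) p^w the left side is ≡ 1 (mod p) for r = 0 by Fermat, and ≡ 0 for 0 < r < p^w
-- because p ∣ M C r; as p ∤ k, induction on r shows that p divides every row sum. Part (i) is the
-- hockey-stick identity Σ_{n<M} (n C r) = M C (r + 1) together with p ∣ M C (r + 1).
module Submission where

open import Defs
open import Data.Nat
  using (ℕ; zero; suc; _+_; _*_; _∸_; _^_; _≤_; _<_; _%_; _/_; NonZero; z<s; s≤s)
open import Data.Nat.Properties
open import Data.Nat.Combinatorics
  using (_C_; nCk+nC[k+1]≡[n+1]C[k+1]; nC1≡n; nCn≡1; k>n⇒nCk≡0)
open import Data.Nat.Divisibility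
open import Data.Nat.DivMod using (m≡m%n+[m/n]*n; %-remove-+ˡ; %-remove-+ʳ; %-distribˡ-+; %-distribˡ-*)
open import Data.Nat.Primality using (Prime; euclidsLemma; prime⇒nonZero)
open import Data.Product using (_×_; _,_)
open import Data.Sum using (inj₁; inj₂)
open import Relation.Nullary using (yes; no; ¬_; contradiction)
open import Data.Nat.Tactic.RingSolver using (solve-∀)
open import Algebra.Properties.CommutativeSemigroup +-commutativeSemigroup
  using () renaming (interchange to +-interchange)
open import Algebra.Properties.CommutativeSemigroup *-commutativeSemigroup
  using () renaming (x∙yz≈y∙xz to x*[y*z]≡y*[x*z])
open import Relation.Binary.PropositionalEquality
open ≡-Reasoning

∑< : ℕ → (ℕ → ℕ) → ℕ
∑< zero    f = 0
∑< (suc n) f = ∑< n f + f n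

infix 6.5 ∑<
syntax ∑< n (λ l → e) = ∑[ l < n ] e

sum1≡∑ : ∀ n f → sum1 n f ≡ ∑[ l < n ] f (suc l)
sum1≡∑ zero    f = refl
sum1≡∑ (suc n) f = cong (_+ f (suc n)) (sum1≡∑ n f)

∑-cong : ∀ n {f g : ℕ → ℕ} → (∀ l → f l ≡ g l) → ∑< n f ≡ ∑< n g
∑-cong zero    f≗g = refl
∑-cong (suc n) f≗g = cong₂ _+_ (∑-cong n f≗g) (f≗g n)

∑-zero : ∀ n → ∑[ l < n ] 0 ≡ 0
∑-zero zero    = refl
∑-zero (suc n) = trans (+-identityʳ _) (∑-zero n)

∑-distrib-+ : ∀ n f g → ∑[ l < n ] (f l + g l) ≡ ∑< n f + ∑< n g
∑-distrib-+ zero    f g = refl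
∑-distrib-+ (suc n) f g = begin
  ∑[ l < n ] (f l + g l) + (f n + g n) ≡⟨ cong (_+ (f n + g n)) (∑-distrib-+ n f g) ⟩
  (∑< n f + ∑< n g) + (f n + g n)     ≡⟨ +-interchange (∑< n f) (∑< n g) (f n) (g n) ⟩
  (∑< n f + f n) + (∑< n g + g n)     ∎

*-distribˡ-∑ : ∀ n c f → ∑[ l < n ] c * f l ≡ c * ∑< n f
*-distribˡ-∑ zero    c f = sym (*-zeroʳ c)
*-distribˡ-∑ (suc n) c f = begin
  ∑[ l < n ] c * f l + c * f n ≡⟨ cong (_+ c * f n) (*-distribˡ-∑ n c f) ⟩
  c * ∑< n f + c * f n         ≡⟨ *-distribˡ-+ c (∑< n f) (f n) ⟨
  c * (∑< n f + f n)           ∎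

∑-suc : ∀ n f → ∑< (suc n) f ≡ f 0 + ∑[ l < n ] f (suc l)
∑-suc zero    f = +-comm 0 (f 0)
∑-suc (suc n) f = begin
  ∑< (suc n) f + f (suc n)                ≡⟨ cong (_+ f (suc n)) (∑-suc n f) ⟩
  f 0 + ∑[ l < n ] f (suc l) + f (suc n)  ≡⟨ +-assoc (f 0) _ _ ⟩
  f 0 + ∑[ l < suc n ] f (suc l)          ∎

∑-telescope : ∀ (f h : ℕ → ℕ) → (∀ n → f (suc n) ≡ f n + h n) →
              ∀ M → f M ≡ f 0 + ∑< M h
∑-telescope f h step zero    = sym (+-identityʳ (f 0))
∑-telescope f h step (suc M) = begin
  f (suc M)              ≡⟨ step M ⟩
  f M + h M              ≡⟨ cong (_+ h M) (∑-telescope f h step M) ⟩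
  f 0 + ∑< M h + h M     ≡⟨ +-assoc (f 0) _ _ ⟩
  f 0 + ∑< (suc M) h     ∎

P[_] : ℕ → Mat
P[ x ] i j = (j C i) * x ^ (j ∸ i)

above : Mat → Mat
above A zero    j = 0
above A (suc i) j = A i j

P[1]≡C : ∀ i j → P[ 1 ] i j ≡ j C i
P[1]≡C i j = trans (cong ((j C i) *_) (^-zeroˡ (j ∸ i))) (*-identityʳ (j C i))

P[x]i0≡P[y]i0 : ∀ x y i → P[ x ] i 0 ≡ P[ y ] i 0
P[x]i0≡P[y]i0 x y zero    = refl
P[x]i0≡P[y]i0 x y (suc i) = refl

-- For l > j the exponents on the two sides differ, but then j C l vanishes.
jCl*x^[1+j∸l]≡x*P[x]lj : ∀ x j l → (j C l) * x ^ (suc j ∸ l) ≡ x * P[ x ] l j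
jCl*x^[1+j∸l]≡x*P[x]lj x j l with l ≤? j
... | yes l≤j = begin
  (j C l) * x ^ (suc j ∸ l)    ≡⟨ cong (λ e → (j C l) * x ^ e) (+-∸-assoc 1 l≤j) ⟩
  (j C l) * (x * x ^ (j ∸ l))  ≡⟨ x*[y*z]≡y*[x*z] (j C l) x (x ^ (j ∸ l)) ⟩
  x * P[ x ] l j               ∎
... | no l≰j rewrite k>n⇒nCk≡0 (≰⇒> l≰j) = sym (*-zeroʳ x)

P[x]-suc : ∀ x i j → P[ x ] i (suc j) ≡ above P[ x ] i j + x * P[ x ] i j
P[x]-suc x zero    j = jCl*x^[1+j∸l]≡x*P[x]lj x j 0
P[x]-suc x (suc i) j = begin
  (suc j C suc i) * x ^ (j ∸ i)
    ≡⟨ cong (_* x ^ (j ∸ i)) (nCk+nC[k+1]≡[n+1]C[k+1] j i) ⟨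
  ((j C i) + (j C suc i)) * x ^ (j ∸ i)
    ≡⟨ *-distribʳ-+ (x ^ (j ∸ i)) (j C i) (j C suc i) ⟩
  P[ x ] i j + (j C suc i) * x ^ (suc j ∸ suc i)
    ≡⟨ cong (P[ x ] i j +_) (jCl*x^[1+j∸l]≡x*P[x]lj x j (suc i)) ⟩
  P[ x ] i j + x * P[ x ] (suc i) j ∎

∑-*above : ∀ N (u : ℕ → ℕ) (B : Mat) j →
           ∑[ l < suc N ] u l * above B l j ≡ ∑[ l < N ] u (suc l) * B l j
∑-*above N u B j =
  trans (∑-suc N (λ l → u l * above B l j)) (cong (_+ ∑[ l < N ] u (suc l) * B l j) (*-zeroʳ (u 0)))

P[a]P[c]-suc : ∀ a c i j N →
  ∑[ l < suc N ] P[ a ] i l * P[ c ] l (suc j)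
    ≡ ∑[ l < N ] above P[ a ] i l * P[ c ] l j + a * (∑[ l < N ] P[ a ] i l * P[ c ] l j)
      + c * (∑[ l < suc N ] P[ a ] i l * P[ c ] l j)
P[a]P[c]-suc a c i j N = begin
  ∑[ l < suc N ] P[ a ] i l * P[ c ] l (suc j)
    ≡⟨ ∑-cong (suc N) (λ l → trans (cong (P[ a ] i l *_) (P[x]-suc c l j))
                                   (distrib (P[ a ] i l) (above P[ c ] l j) c (P[ c ] l j))) ⟩
  ∑[ l < suc N ] (P[ a ] i l * above P[ c ] l j + c * (P[ a ] i l * P[ c ] l j))
    ≡⟨ ∑-distrib-+ (suc N) _ _ ⟩
  ∑[ l < suc N ] P[ a ] i l * above P[ c ] l j + ∑[ l < suc N ] c * (P[ a ] i l * P[ c ] l j)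
    ≡⟨ cong₂ _+_ (∑-*above N (P[ a ] i) P[ c ] j) (*-distribˡ-∑ (suc N) c _) ⟩
  ∑[ l < N ] P[ a ] i (suc l) * P[ c ] l j + c * (∑[ l < suc N ] P[ a ] i l * P[ c ] l j)
    ≡⟨ cong (_+ c * (∑[ l < suc N ] P[ a ] i l * P[ c ] l j)) shiftedRow ⟩
  ∑[ l < N ] above P[ a ] i l * P[ c ] l j + a * (∑[ l < N ] P[ a ] i l * P[ c ] l j)
    + c * (∑[ l < suc N ] P[ a ] i l * P[ c ] l j) ∎
  where
  distrib : ∀ x y c z → x * (y + c * z) ≡ x * y + c * (x * z)
  distrib = solve-∀

  shiftedRow : ∑[ l < N ] P[ a ] i (suc l) * P[ c ] l j
             ≡ ∑[ l < N ] above P[ a ] i l * P[ c ] l j + a * (∑[ l < N ] P[ a ] i l * P[ c ] l j)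
  shiftedRow = begin
    ∑[ l < N ] P[ a ] i (suc l) * P[ c ] l j
      ≡⟨ ∑-cong N (λ l → cong (_* P[ c ] l j) (P[x]-suc a i l)) ⟩
    ∑[ l < N ] (above P[ a ] i l + a * P[ a ] i l) * P[ c ] l j
      ≡⟨ ∑-cong N (λ l → *-distribʳ-+ (P[ c ] l j) (above P[ a ] i l) (a * P[ a ] i l)) ⟩
    ∑[ l < N ] (above P[ a ] i l * P[ c ] l j + a * P[ a ] i l * P[ c ] l j)
      ≡⟨ ∑-distrib-+ N _ _ ⟩
    ∑[ l < N ] above P[ a ] i l * P[ c ] l j + ∑[ l < N ] a * P[ a ] i l * P[ c ] l j
      ≡⟨ cong (∑[ l < N ] above P[ a ] i l * P[ c ] l j +_)
              (trans (∑-cong N (λ l → *-assoc a (P[ a ] i l) (P[ c ] l j))) (*-distribˡ-∑ N a _)) ⟩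
    ∑[ l < N ] above P[ a ] i l * P[ c ] l j + a * (∑[ l < N ] P[ a ] i l * P[ c ] l j) ∎

P[a]P[c]≡P[a+c] : ∀ a c i j {N} → j < N →
                  ∑[ l < N ] P[ a ] i l * P[ c ] l j ≡ P[ a + c ] i j
P[a]P[c]≡P[a+c] a c i zero {suc N} _ = begin
  ∑[ l < suc N ] P[ a ] i l * P[ c ] l 0
    ≡⟨ ∑-suc N _ ⟩
  P[ a ] i 0 * 1 + ∑[ l < N ] P[ a ] i (suc l) * 0
    ≡⟨ cong₂ _+_ (*-identityʳ (P[ a ] i 0))
                 (trans (∑-cong N (λ l → *-zeroʳ (P[ a ] i (suc l)))) (∑-zero N)) ⟩
  P[ a ] i 0 + 0
    ≡⟨ +-identityʳ _ ⟩
  P[ a ] i 0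
    ≡⟨ P[x]i0≡P[y]i0 a (a + c) i ⟩
  P[ a + c ] i 0 ∎
P[a]P[c]≡P[a+c] a c i (suc j) {suc N} (s≤s j<N) = begin
  ∑[ l < suc N ] P[ a ] i l * P[ c ] l (suc j)
    ≡⟨ P[a]P[c]-suc a c i j N ⟩
  ∑[ l < N ] above P[ a ] i l * P[ c ] l j + a * (∑[ l < N ] P[ a ] i l * P[ c ] l j)
    + c * (∑[ l < suc N ] P[ a ] i l * P[ c ] l j)
    ≡⟨ cong₂ _+_ (cong₂ _+_ (∑-above-row i) (cong (a *_) (P[a]P[c]≡P[a+c] a c i j j<N)))
                 (cong (c *_) (P[a]P[c]≡P[a+c] a c i j (m<n⇒m<1+n j<N))) ⟩
  above P[ a + c ] i j + a * P[ a + c ] i j + c * P[ a + c ] i j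
    ≡⟨ collect (above P[ a + c ] i j) a c (P[ a + c ] i j) ⟩
  above P[ a + c ] i j + (a + c) * P[ a + c ] i j
    ≡⟨ P[x]-suc (a + c) i j ⟨
  P[ a + c ] i (suc j) ∎
  where
  collect : ∀ u a c v → u + a * v + c * v ≡ u + (a + c) * v
  collect = solve-∀

  ∑-above-row : ∀ i → ∑[ l < N ] above P[ a ] i l * P[ c ] l j ≡ above P[ a + c ] i j
  ∑-above-row zero    = ∑-zero N
  ∑-above-row (suc i) = P[a]P[c]≡P[a+c] a c i j j<N

identity≡P[0] : ∀ i j → identity (suc i) (suc j) ≡ P[ 0 ] i j
identity≡P[0] zero    zero    = refl
identity≡P[0] zero    (suc j) = refl
identity≡P[0] (suc i) zero    = refl
identity≡P[0] (suc i) (suc j) = begin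
  identity (suc i) (suc j)  ≡⟨ identity≡P[0] i j ⟩
  P[ 0 ] i j                ≡⟨ +-identityʳ (P[ 0 ] i j) ⟨
  P[ 0 ] i j + 0            ≡⟨ P[x]-suc 0 (suc i) j ⟨
  P[ 0 ] (suc i) (suc j)    ∎

pascalPow≡P[k] : ∀ k i j → pascalPow k (suc i) (suc j) ≡ P[ k ] i j
pascalPow≡P[k] zero    i j = identity≡P[0] i j
pascalPow≡P[k] (suc k) i j = begin
  sum1 (suc j) (λ l → pascal (suc i) l * pascalPow k l (suc j))
    ≡⟨ sum1≡∑ (suc j) _ ⟩
  ∑[ l < suc j ] (l C i) * pascalPow k (suc l) (suc j)
    ≡⟨ ∑-cong (suc j) (λ l → cong₂ _*_ (sym (P[1]≡C i l)) (pascalPow≡P[k] k l j)) ⟩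
  ∑[ l < suc j ] P[ 1 ] i l * P[ k ] l j
    ≡⟨ P[a]P[c]≡P[a+c] 1 k i j ≤-refl ⟩
  P[ suc k ] i j ∎

[1+a]^n≡∑P[a]ln : ∀ a n → suc a ^ n ≡ ∑[ l < suc n ] P[ a ] l n
[1+a]^n≡∑P[a]ln a n = begin
  suc a ^ n                                ≡⟨ *-identityˡ (suc a ^ n) ⟨
  P[ suc a ] 0 n                           ≡⟨ P[a]P[c]≡P[a+c] 1 a 0 n ≤-refl ⟨
  ∑[ l < suc n ] P[ 1 ] 0 l * P[ a ] l n
    ≡⟨ ∑-cong (suc n) (λ l → trans (cong (_* P[ a ] l n) (P[1]≡C 0 l)) (*-identityˡ (P[ a ] l n))) ⟩
  ∑[ l < suc n ] P[ a ] l n                ∎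

∑nCr≡MC[1+r] : ∀ M r → ∑[ n < M ] (n C r) ≡ M C suc r
∑nCr≡MC[1+r] M r = sym (∑-telescope (_C suc r) (_C r) pascal-rule M)
  where
  pascal-rule : ∀ n → suc n C suc r ≡ n C suc r + n C r
  pascal-rule n = trans (sym (nCk+nC[k+1]≡[n+1]C[k+1] n r)) (+-comm (n C r) (n C suc r))

P[1+k]-row-telescope : ∀ k i M →
  P[ suc k ] i M ≡ P[ suc k ] i 0 + (∑[ n < M ] above P[ suc k ] i n + k * ∑< M (P[ suc k ] i))
P[1+k]-row-telescope k i M = begin
  P[ suc k ] i M
    ≡⟨ ∑-telescope (P[ suc k ] i) (λ n → above P[ suc k ] i n + k * P[ suc k ] i n) step M ⟩
  P[ suc k ] i 0 + ∑[ n < M ] (above P[ suc k ] i n + k * P[ suc k ] i n)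
    ≡⟨ cong (P[ suc k ] i 0 +_) (∑-distrib-+ M _ _) ⟩
  P[ suc k ] i 0 + (∑[ n < M ] above P[ suc k ] i n + ∑[ n < M ] k * P[ suc k ] i n)
    ≡⟨ cong (λ s → P[ suc k ] i 0 + (∑[ n < M ] above P[ suc k ] i n + s)) (*-distribˡ-∑ M k _) ⟩
  P[ suc k ] i 0 + (∑[ n < M ] above P[ suc k ] i n + k * ∑< M (P[ suc k ] i)) ∎
  where
  regroup : ∀ u k v → u + suc k * v ≡ v + (u + k * v)
  regroup = solve-∀
  step : ∀ n → P[ suc k ] i (suc n) ≡ P[ suc k ] i n + (above P[ suc k ] i n + k * P[ suc k ] i n)
  step n = trans (P[x]-suc (suc k) i n) (regroup (above P[ suc k ] i n) k (P[ suc k ] i n))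

∑-∣ : ∀ {d} n {f : ℕ → ℕ} → (∀ l → l < n → d ∣ f l) → d ∣ ∑< n f
∑-∣ zero    d∣f = _ ∣0
∑-∣ (suc n) d∣f = ∣m∣n⇒∣m+n (∑-∣ n (λ l l<n → d∣f l (m<n⇒m<1+n l<n))) (d∣f n ≤-refl)

[1+k]*[1+n]C[1+k]≡[1+n]*nCk : ∀ n k → suc k * (suc n C suc k) ≡ suc n * (n C k)
[1+k]*[1+n]C[1+k]≡[1+n]*nCk zero    zero    = refl
[1+k]*[1+n]C[1+k]≡[1+n]*nCk zero    (suc k) = *-zeroʳ (suc (suc k))
[1+k]*[1+n]C[1+k]≡[1+n]*nCk (suc n) zero    =
  trans (*-identityˡ (suc (suc n) C 1)) (trans (nC1≡n (suc (suc n))) (sym (*-identityʳ (suc (suc n)))))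
[1+k]*[1+n]C[1+k]≡[1+n]*nCk (suc n) (suc k) = begin
  suc (suc k) * (suc (suc n) C suc (suc k))
    ≡⟨ cong (suc (suc k) *_) (nCk+nC[k+1]≡[n+1]C[k+1] (suc n) (suc k)) ⟨
  suc (suc k) * (X + Y)
    ≡⟨ split k X Y ⟩
  (suc k * X + X) + suc (suc k) * Y
    ≡⟨ cong₂ (λ u v → (u + X) + v) ([1+k]*[1+n]C[1+k]≡[1+n]*nCk n k)
                                   ([1+k]*[1+n]C[1+k]≡[1+n]*nCk n (suc k)) ⟩
  (suc n * (n C k) + X) + suc n * (n C suc k)
    ≡⟨ regroup n (n C k) (n C suc k) X ⟩
  suc n * ((n C k) + (n C suc k)) + X
    ≡⟨ cong (λ u → suc n * u + X) (nCk+nC[k+1]≡[n+1]C[k+1] n k) ⟩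
  suc n * X + X
    ≡⟨ +-comm (suc n * X) X ⟩
  suc (suc n) * X ∎
  where
  X = suc n C suc k
  Y = suc n C suc (suc k)
  split : ∀ k x y → (2 + k) * (x + y) ≡ ((1 + k) * x + x) + (2 + k) * y
  split = solve-∀
  regroup : ∀ n a b x → ((1 + n) * a + x) + (1 + n) * b ≡ (1 + n) * (a + b) + x
  regroup = solve-∀

p^v∣m*n⇒p^v∣m : ∀ {p n} → Prime p → ¬ p ∣ n → ∀ v {m} → p ^ v ∣ m * n → p ^ v ∣ m
p^v∣m*n⇒p^v∣m         pr p∤n zero    {m} _ = 1∣ m
p^v∣m*n⇒p^v∣m {p} {n} pr p∤n (suc v) {m} pᵛ⁺¹∣mn
  with euclidsLemma m n pr (∣-trans (m∣m*n (p ^ v)) pᵛ⁺¹∣mn)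
... | inj₂ p∣n = contradiction p∣n p∤n
... | inj₁ (divides q refl) =
  subst (p * p ^ v ∣_) (*-comm p q) (*-monoʳ-∣ p (p^v∣m*n⇒p^v∣m pr p∤n v pᵛ∣qn))
  where
  pᵛ∣qn : p ^ v ∣ q * n
  pᵛ∣qn = *-cancelˡ-∣ p {{prime⇒nonZero pr}}
            (subst (p * p ^ v ∣_) (trans (cong (_* n) (*-comm q p)) (*-assoc p q n)) pᵛ⁺¹∣mn)

p∣nCk : ∀ {p v n k} → Prime p → p ^ v ∣ n → 0 < k → k < p ^ v → p ∣ n C k
p∣nCk {k = zero}                  _  _    ()  _
p∣nCk {p} {n = zero}    {suc k}   _  _    _   _ = p ∣0
p∣nCk {p} {v} {suc n}   {suc k}   pr pᵛ∣n _   k<pᵛ with p ∣? (suc n C suc k)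
... | yes p∣C = p∣C
... | no  p∤C = contradiction (∣⇒≤ (p^v∣m*n⇒p^v∣m pr p∤C v pᵛ∣[1+k]C)) (<⇒≱ k<pᵛ)
  where
  pᵛ∣[1+k]C : p ^ v ∣ suc k * (suc n C suc k)
  pᵛ∣[1+k]C = subst (p ^ v ∣_) (sym ([1+k]*[1+n]C[1+k]≡[1+n]*nCk n k)) (∣m⇒∣m*n (n C k) pᵛ∣n)

[m+n]%d≡n%d⇒d∣m : ∀ m n d .{{_ : NonZero d}} → (m + n) % d ≡ n % d → d ∣ m
[m+n]%d≡n%d⇒d∣m m n d eq =
  ∣m+n∣m⇒∣n (subst (d ∣_) (sym quotients) (n∣m*n ((m + n) / d))) (n∣m*n (n / d))
  where
  quotients : (n / d) * d + m ≡ ((m + n) / d) * d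
  quotients = +-cancelˡ-≡ (n % d) _ _ (begin
    n % d + ((n / d) * d + m)         ≡⟨ +-assoc (n % d) _ m ⟨
    n % d + (n / d) * d + m           ≡⟨ cong (_+ m) (m≡m%n+[m/n]*n n d) ⟨
    n + m                             ≡⟨ +-comm n m ⟩
    m + n                             ≡⟨ m≡m%n+[m/n]*n (m + n) d ⟩
    (m + n) % d + ((m + n) / d) * d   ≡⟨ cong (_+ ((m + n) / d) * d) eq ⟩
    n % d + ((m + n) / d) * d         ∎)

[1+a]^p%p≡[a^p+1]%p : ∀ {p} .{{_ : NonZero p}} → Prime p → ∀ a → suc a ^ p % p ≡ (a ^ p + 1) % p
[1+a]^p%p≡[a^p+1]%p {suc q} pr a = begin
  suc a ^ p % p                 ≡⟨ cong (_% p) expand ⟩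
  (X + (a ^ p + 1)) % p         ≡⟨ %-remove-+ˡ (a ^ p + 1) (∑-∣ q p∣middle) ⟩
  (a ^ p + 1) % p               ∎
  where
  p = suc q
  X = ∑[ l < q ] P[ a ] (suc l) p
  p∣middle : ∀ l → l < q → p ∣ P[ a ] (suc l) p
  p∣middle l l<q = ∣m⇒∣m*n (a ^ (p ∸ suc l))
    (p∣nCk {v = 1} pr (∣-reflexive (*-identityʳ p)) z<s (subst (suc l <_) (sym (*-identityʳ p)) (s≤s l<q)))
  P[a]pp≡1 : P[ a ] p p ≡ 1
  P[a]pp≡1 = cong₂ (λ c e → c * a ^ e) (nCn≡1 p) (n∸n≡0 p)
  expand : suc a ^ p ≡ X + (a ^ p + 1)
  expand = begin
    suc a ^ p                                ≡⟨ [1+a]^n≡∑P[a]ln a p ⟩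
    ∑[ l < suc p ] P[ a ] l p                ≡⟨ ∑-suc p (λ l → P[ a ] l p) ⟩
    1 * a ^ p + (X + P[ a ] p p)
      ≡⟨ cong₂ (λ u v → u + (X + v)) (*-identityˡ (a ^ p)) P[a]pp≡1 ⟩
    a ^ p + (X + 1)                          ≡⟨ x+[y+1]≡y+[x+1] (a ^ p) X ⟩
    X + (a ^ p + 1)                          ∎
    where
    x+[y+1]≡y+[x+1] : ∀ x y → x + (y + 1) ≡ y + (x + 1)
    x+[y+1]≡y+[x+1] = solve-∀

fermat : ∀ {p} .{{_ : NonZero p}} → Prime p → ∀ a → a ^ p % p ≡ a % p
fermat {suc q} pr zero    = refl
fermat {p}     pr (suc a) = begin
  suc a ^ p % p                   ≡⟨ [1+a]^p%p≡[a^p+1]%p pr a ⟩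
  (a ^ p + 1) % p                 ≡⟨ %-distribˡ-+ (a ^ p) 1 p ⟩
  (a ^ p % p + 1 % p) % p         ≡⟨ cong (λ u → (u + 1 % p) % p) (fermat pr a) ⟩
  (a % p + 1 % p) % p             ≡⟨ %-distribˡ-+ a 1 p ⟨
  (a + 1) % p                     ≡⟨ cong (_% p) (+-comm a 1) ⟩
  suc a % p                       ∎

fermat-little : ∀ {p} .{{_ : NonZero p}} → Prime p → ∀ {a} → ¬ p ∣ a → a ^ (p ∸ 1) % p ≡ 1 % p
fermat-little {suc q} pr {a} p∤a with a ^ q in aᵠ≡
... | zero  = contradiction (subst (_ ∣_) (sym (m^n≡0⇒m≡0 a q aᵠ≡)) (_ ∣0)) p∤a
... | suc y = %-remove-+ʳ 1 (p∣y)
  where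
  p = suc q
  a*y+a%p≡a%p : (a * y + a) % p ≡ a % p
  a*y+a%p≡a%p = begin
    (a * y + a) % p   ≡⟨ cong (_% p) (trans (+-comm (a * y) a) (sym (*-suc a y))) ⟩
    a * suc y % p     ≡⟨ cong (λ u → a * u % p) aᵠ≡ ⟨
    a ^ p % p         ≡⟨ fermat pr a ⟩
    a % p             ∎
  p∣y : p ∣ y
  p∣y with euclidsLemma a y pr ([m+n]%d≡n%d⇒d∣m (a * y) a p a*y+a%p≡a%p)
  ... | inj₁ p∣a = contradiction p∣a p∤a
  ... | inj₂ p∣y = p∣y

x%d≡1%d⇒xⁿ%d≡1%d : ∀ {x d} .{{_ : NonZero d}} → x % d ≡ 1 % d → ∀ n → x ^ n % d ≡ 1 % d
x%d≡1%d⇒xⁿ%d≡1%d         x≡1 zero    = refl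
x%d≡1%d⇒xⁿ%d≡1%d {x} {d} x≡1 (suc n) = begin
  x * x ^ n % d                 ≡⟨ %-distribˡ-* x (x ^ n) d ⟩
  (x % d) * (x ^ n % d) % d     ≡⟨ cong₂ (λ u v → u * v % d) x≡1 (x%d≡1%d⇒xⁿ%d≡1%d x≡1 n) ⟩
  (1 % d) * (1 % d) % d         ≡⟨ %-distribˡ-* 1 1 d ⟨
  1 % d                         ∎

aᴹ%p≡1%p : ∀ {p a M} .{{_ : NonZero p}} → Prime p → ¬ p ∣ a → (p ∸ 1) ∣ M → a ^ M % p ≡ 1 % p
aᴹ%p≡1%p {p} {a} pr p∤a (divides q refl) = begin
  a ^ (q * (p ∸ 1)) % p     ≡⟨ cong (λ e → a ^ e % p) (*-comm q (p ∸ 1)) ⟩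
  a ^ ((p ∸ 1) * q) % p     ≡⟨ cong (_% p) (^-*-assoc a (p ∸ 1) q) ⟨
  (a ^ (p ∸ 1)) ^ q % p     ≡⟨ x%d≡1%d⇒xⁿ%d≡1%d (fermat-little pr p∤a) q ⟩
  1 % p                     ∎

p∣∑P[1+k]rn : ∀ {p k M w} .{{_ : NonZero p}} → Prime p → ¬ p ∣ suc k → ¬ p ∣ k →
              (p ∸ 1) ∣ M → p ^ w ∣ M → ∀ r → r < p ^ w → p ∣ ∑< M (P[ suc k ] r)
p∣∑P[1+k]rn {p} {k} {M} {w} pr p∤1+k p∤k p-1∣M pʷ∣M = go
  where
  cancel-k : ∀ {s} → p ∣ k * s → p ∣ s
  cancel-k p∣ks with euclidsLemma k _ pr p∣ks
  ... | inj₁ p∣k = contradiction p∣k p∤k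
  ... | inj₂ p∣s = p∣s

  go : ∀ r → r < p ^ w → p ∣ ∑< M (P[ suc k ] r)
  go zero    _ = cancel-k ([m+n]%d≡n%d⇒d∣m (k * S) 1 p (begin
    (k * S + 1) % p                           ≡⟨ cong (_% p) (+-comm (k * S) 1) ⟩
    (1 + k * S) % p                           ≡⟨ cong (λ z → (1 + (z + k * S)) % p) (∑-zero M) ⟨
    (1 + (∑[ n < M ] 0 + k * S)) % p          ≡⟨ cong (_% p) (P[1+k]-row-telescope k 0 M) ⟨
    1 * suc k ^ M % p                         ≡⟨ cong (_% p) (*-identityˡ (suc k ^ M)) ⟩
    suc k ^ M % p                             ≡⟨ aᴹ%p≡1%p pr p∤1+k p-1∣M ⟩
    1 % p                                     ∎))
    where
    S = ∑< M (P[ suc k ] 0)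
  go (suc r) 1+r<pʷ = cancel-k (∣m+n∣m⇒∣n p∣rowSum-rec (go r (<-trans (n<1+n r) 1+r<pʷ)))
    where
    p∣rowSum-rec : p ∣ ∑< M (P[ suc k ] r) + k * ∑< M (P[ suc k ] (suc r))
    p∣rowSum-rec = subst (p ∣_) (P[1+k]-row-telescope k (suc r) M)
                     (∣m⇒∣m*n (suc k ^ (M ∸ suc r)) (p∣nCk {v = w} pr pʷ∣M z<s 1+r<pʷ))

sum1-pascal≡MC[1+r] : ∀ M r → sum1 M (pascal (suc r)) ≡ M C suc r
sum1-pascal≡MC[1+r] M r = trans (sum1≡∑ M (pascal (suc r))) (∑nCr≡MC[1+r] M r)

sum1-pascalPow≡∑P[k] : ∀ k r M → sum1 M (pascalPow k (suc r)) ≡ ∑< M (P[ k ] r)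
sum1-pascalPow≡∑P[k] k r M = trans (sum1≡∑ M (pascalPow k (suc r))) (∑-cong M (pascalPow≡P[k] k r))

mainTheorem13 : (b : ℕ) → .{{_ : NonZero b}} → Prime b → (w : ℕ) →
    ((i : ℕ) → 1 ≤ i → i ≤ b ^ w ∸ 1 →
      sum1 ((b ∸ 1) * b ^ w) (λ j → pascal i j) % b ≡ 0)
    × ((k i : ℕ) → 2 ≤ k → k ≤ b ∸ 1 → 1 ≤ i → i ≤ b ^ w →
      sum1 ((b ∸ 1) * b ^ w) (λ j → pascalPow k i j) % b ≡ 0)
mainTheorem13 b pr w = part-i , part-ii
  where
  M = (b ∸ 1) * b ^ w

  b-1∣M : (b ∸ 1) ∣ M
  b-1∣M = m∣m*n (b ^ w)

  bʷ∣M : b ^ w ∣ M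
  bʷ∣M = n∣m*n (b ∸ 1)

  part-i : (i : ℕ) → 1 ≤ i → i ≤ b ^ w ∸ 1 → sum1 M (pascal i) % b ≡ 0
  part-i (suc r) _ 1+r≤bʷ-1 = n∣m⇒m%n≡0 _ b (subst (b ∣_) (sym (sum1-pascal≡MC[1+r] M r))
    (p∣nCk {v = w} pr bʷ∣M z<s (m≤pred[n]⇒suc[m]≤n {{m^n≢0 b w}} 1+r≤bʷ-1)))

  part-ii : (k i : ℕ) → 2 ≤ k → k ≤ b ∸ 1 → 1 ≤ i → i ≤ b ^ w →
            sum1 M (pascalPow k i) % b ≡ 0
  part-ii 1             _       (s≤s ()) _ _ _
  part-ii (suc (suc k)) (suc r) _ 2+k≤b-1 _ 1+r≤bʷ = n∣m⇒m%n≡0 _ b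
    (subst (b ∣_) (sym (sum1-pascalPow≡∑P[k] (suc (suc k)) r M))
      (p∣∑P[1+k]rn {w = w} pr (>⇒∤ 2+k<b) (>⇒∤ 1+k<b) b-1∣M bʷ∣M r 1+r≤bʷ))
    where
    2+k<b : suc (suc k) < b
    2+k<b = m≤pred[n]⇒suc[m]≤n 2+k≤b-1
    1+k<b : suc k < b
    1+k<b = <-trans (n<1+n (suc k)) 2+k<b
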